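{- Let $G=(V,E)$ be a connected simple graph with a set-valued metric $\Omega(-,-)$ taking values in subsets of a set $\Omega$, and suppose there is an equivariant involution $x\mapsto -x$ on $V$. Then $G$ has diameter at least $|\Omega|$.
   Context: A set-valued metric on $G$ is a function $\Omega(-,-):V\times V\to 2^\Omega$ with $\Omega(x,y)=\Omega(y,x)$, $|\Omega(x,y)|=1$ for every edge $\{x,y\}$, and $\Omega(x,z)=\Omega(x,y)\triangle\Omega(y,z)$ (symmetric difference) for all $x,y,z$. An involution $x\mapsto -x$ on $V$ is equivariant if $\Omega(x,-y)=\Omega\setminus\Omega(x,y)$ for all $x,y\in V$. The diameter is the maximum graph distance between two vertices. -}

module Defs where

open import Level using (Level; _⊔_)
open import Data.Nat using (ℕ; zero; suc; _≤_)
open import Data.Fin using (Fin)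
open import Data.Fin.Subset using (Subset; ∁; ∣_∣)
open import Data.Bool using (_xor_)
open import Data.Vec using (zipWith)
open import Data.Product using (Σ; _×_; _,_)
open import Relation.Binary.PropositionalEquality using (_≡_)
open import Relation.Nullary using (¬_)

_△_ : ∀ {m} → Subset m → Subset m → Subset m
_△_ = zipWith _xor_

record IsSimpleGraph {a ℓ} {V : Set a} (Adj : V → V → Set ℓ) : Set (a ⊔ ℓ) where
  field
    symm  : ∀ {x y} → Adj x y → Adj y x
    irrefl : ∀ {x} → ¬ Adj x x

data Walk {a ℓ} {V : Set a} (Adj : V → V → Set ℓ) : V → V → ℕ → Set (a ⊔ ℓ) where
  here : ∀ {x} → Walk Adj x x zero
  step : ∀ {x y z k} → Adj x y → Walk Adj y z k → Walk Adj x z (suc k)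

Connected : ∀ {a ℓ} {V : Set a} (Adj : V → V → Set ℓ) → Set (a ⊔ ℓ)
Connected {V = V} Adj = ∀ (x y : V) → Σ ℕ (λ k → Walk Adj x y k)

DistAtLeast : ∀ {a ℓ} {V : Set a} (Adj : V → V → Set ℓ) → V → V → ℕ → Set (a ⊔ ℓ)
DistAtLeast Adj x y d = ∀ k → Walk Adj x y k → d ≤ k

DiameterAtLeast : ∀ {a ℓ} {V : Set a} (Adj : V → V → Set ℓ) → ℕ → Set (a ⊔ ℓ)
DiameterAtLeast {V = V} Adj d = Σ V (λ x → Σ V (λ y → DistAtLeast Adj x y d))

record IsSetValuedMetric {a ℓ} {V : Set a} (Adj : V → V → Set ℓ) {m : ℕ}
                         (ω : V → V → Subset m) : Set (a ⊔ ℓ) where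
  field
    sym   : ∀ x y → ω x y ≡ ω y x
    edge  : ∀ {x y} → Adj x y → ∣ ω x y ∣ ≡ 1
    triangle : ∀ x y z → ω x z ≡ ω x y △ ω y z

record IsEquivariantInvolution {a} {V : Set a} {m : ℕ}
                               (ω : V → V → Subset m) (neg : V → V) : Set a where
  field
    involutive : ∀ x → neg (neg x) ≡ x
    equivariant : ∀ x y → ω x (neg y) ≡ ∁ (ω x y)

-- Along every edge the metric changes by a single element, so a walk of length k from x to y
-- forces |Ω(x,y)| ≤ k. The triangle law with x = y = z gives Ω(x,x) = ∅, so equivariance gives
-- Ω(x,-x) = Ω; hence every walk from x to -x has length at least |Ω|.
module Submission where

open import Defs
open import Data.Nat using (ℕ; suc; _≤_; _+_; _∸_; z≤n; s≤s)
open import Data.Nat.Properties using (≤-trans; ≤-reflexive; m≤n⇒m≤1+n; n≤1+n; +-monoʳ-≤; +-suc; module ≤-Reasoning)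
open import Data.Fin using (Fin)
open import Data.Fin.Subset using (Subset; ⊥; ∁; ∣_∣; inside; outside)
open import Data.Fin.Subset.Properties using (∣⊥∣≡0; ∣∁p∣≡n∸∣p∣)
open import Data.Bool.Properties using (xor-same)
open import Data.Vec using (_∷_; [])
open import Data.Product using (_,_)
open import Relation.Binary.PropositionalEquality using (_≡_; refl; cong; cong₂; trans; sym; subst; module ≡-Reasoning)

∣p△q∣≤∣p∣+∣q∣ : ∀ {m} (p q : Subset m) → ∣ p △ q ∣ ≤ ∣ p ∣ + ∣ q ∣
∣p△q∣≤∣p∣+∣q∣ []            []            = z≤n
∣p△q∣≤∣p∣+∣q∣ (inside  ∷ p) (inside  ∷ q) =
  m≤n⇒m≤1+n (≤-trans (∣p△q∣≤∣p∣+∣q∣ p q) (+-monoʳ-≤ ∣ p ∣ (n≤1+n ∣ q ∣)))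
∣p△q∣≤∣p∣+∣q∣ (inside  ∷ p) (outside ∷ q) = s≤s (∣p△q∣≤∣p∣+∣q∣ p q)
∣p△q∣≤∣p∣+∣q∣ (outside ∷ p) (inside  ∷ q) =
  ≤-trans (s≤s (∣p△q∣≤∣p∣+∣q∣ p q)) (≤-reflexive (sym (+-suc ∣ p ∣ ∣ q ∣)))
∣p△q∣≤∣p∣+∣q∣ (outside ∷ p) (outside ∷ q) = ∣p△q∣≤∣p∣+∣q∣ p q

p△p≡⊥ : ∀ {m} (p : Subset m) → p △ p ≡ ⊥
p△p≡⊥ []      = refl
p△p≡⊥ (x ∷ p) = cong₂ _∷_ (xor-same x) (p△p≡⊥ p)

module SetValuedMetric {a ℓ} {V : Set a} {Adj : V → V → Set ℓ} {m : ℕ} {ω : V → V → Subset m}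
                       (metric : IsSetValuedMetric Adj ω) where
  open IsSetValuedMetric metric using (edge; triangle)

  ω-refl : ∀ x → ω x x ≡ ⊥
  ω-refl x = trans (triangle x x x) (p△p≡⊥ (ω x x))

  ∣ω∣≤walk-length : ∀ {x y k} → Walk Adj x y k → ∣ ω x y ∣ ≤ k
  ∣ω∣≤walk-length {x} here = ≤-reflexive (trans (cong ∣_∣ (ω-refl x)) (∣⊥∣≡0 m))
  ∣ω∣≤walk-length {x} {z} {suc k} (step {y = y} x~y w) = begin
    ∣ ω x z ∣                 ≡⟨ cong ∣_∣ (triangle x y z) ⟩
    ∣ ω x y △ ω y z ∣         ≤⟨ ∣p△q∣≤∣p∣+∣q∣ (ω x y) (ω y z) ⟩
    ∣ ω x y ∣ + ∣ ω y z ∣     ≡⟨ cong (_+ ∣ ω y z ∣) (edge x~y) ⟩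
    suc ∣ ω y z ∣             ≤⟨ s≤s (∣ω∣≤walk-length w) ⟩
    suc k                     ∎
    where open ≤-Reasoning

  distAtLeast-∣ω∣ : ∀ x y → DistAtLeast Adj x y ∣ ω x y ∣
  distAtLeast-∣ω∣ x y _ = ∣ω∣≤walk-length

  ∣ω-antipode∣≡∣Ω∣ : ∀ {neg} → IsEquivariantInvolution ω neg → ∀ x → ∣ ω x (neg x) ∣ ≡ m
  ∣ω-antipode∣≡∣Ω∣ {neg} equivariantInvolution x = begin
    ∣ ω x (neg x) ∣   ≡⟨ cong ∣_∣ (equivariant x x) ⟩
    ∣ ∁ (ω x x) ∣     ≡⟨ ∣∁p∣≡n∸∣p∣ (ω x x) ⟩
    m ∸ ∣ ω x x ∣     ≡⟨ cong (λ p → m ∸ ∣ p ∣) (ω-refl x) ⟩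
    m ∸ ∣ ⊥ {m} ∣     ≡⟨ cong (m ∸_) (∣⊥∣≡0 m) ⟩
    m                 ∎
    where open IsEquivariantInvolution equivariantInvolution using (equivariant)
          open ≡-Reasoning

proposition3p8 : (n m : ℕ) (Adj : Fin n → Fin n → Set) (ω : Fin n → Fin n → Subset m)
    (neg : Fin n → Fin n) → Fin n → IsSimpleGraph Adj → Connected Adj
    → IsSetValuedMetric Adj ω → IsEquivariantInvolution ω neg
    → DiameterAtLeast Adj m
proposition3p8 n m Adj ω neg x _ _ metric equivariantInvolution =
  x , neg x , subst (DistAtLeast Adj x (neg x)) (∣ω-antipode∣≡∣Ω∣ equivariantInvolution x)
                    (distAtLeast-∣ω∣ x (neg x))
  where open SetValuedMetric metric
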